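{- Let $x$ be a string and let $\mathit{ST}(x)$ be its suffix tree. Then on any single edge of $\mathit{ST}(x)$ there is at most one implicit node $v$ such that $\mathit{str}(v)$ is a palindrome.
   Context: The suffix tree $\mathit{ST}(x)$ of a string $x$ is the compacted trie of all non-empty suffixes of $x\$$, where $\$$ is a symbol not occurring in $x$: a rooted tree with edges labeled by non-empty strings, in which the concatenations of labels along root-to-leaf paths are exactly the suffixes of $x\$$, every non-leaf node has at least two children, and the edge labels to the children of a node begin with distinct letters. The nodes of this tree are explicit nodes; positions strictly inside edges (corresponding to proper non-empty prefixes of an edge label) are implicit nodes. For a (possibly implicit) node $v$, $\mathit{str}(v)$ is the concatenation of edge labels on the path from the root to $v$. A string $w$ is a palindrome if it equals its reverse. -}

module Defs where

open import Data.Bool using (Bool; true; false)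
open import Data.Maybe using (Maybe; just; nothing)
open import Data.List using (List; []; _∷_; _++_; map; reverse; length; head)
open import Data.List.Relation.Unary.All using (All)
open import Data.List.Relation.Unary.AllPairs using (AllPairs)
open import Data.List.Membership.Propositional using (_∈_)
open import Data.Nat using (_≤_)
open import Data.Product using (_×_; _,_; proj₁; proj₂; Σ; ∃)
open import Data.Sum using (_⊎_)
open import Relation.Binary.PropositionalEquality using (_≡_; _≢_)
open import Function.Bundles using (_⇔_)

-- Strings over an alphabet A; the terminator $ is `nothing`,
-- so x$ is a string over Maybe A in which $ does not occur in x.
_$ : {A : Set} → List A → List (Maybe A)
x $ = map just x ++ (nothing ∷ [])

data Tree (B : Set) : Set where
  node : List (List B × Tree B) → Tree B

-- The Bool says whether the node
-- is the root (the root is exempt from the "at least two children" rule, so that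
-- ST(ε) — a root with the single edge "$" — exists).
data WF {B : Set} : Bool → Tree B → Set where
  wf : ∀ {b cs} →
       (b ≡ true ⊎ (cs ≡ [] ⊎ 2 ≤ length cs)) →
       All (λ c → (proj₁ c ≢ []) × WF false (proj₂ c)) cs →
       AllPairs (λ c d → head (proj₁ c) ≢ head (proj₁ d)) cs →
       WF b (node cs)

data LeafStr {B : Set} : Tree B → List B → Set where
  leaf  : LeafStr (node []) []
  child : ∀ {cs lab t s} → (lab , t) ∈ cs → LeafStr t s → LeafStr (node cs) (lab ++ s)

-- EdgeAt T pre lab : T has an edge labelled lab whose upper endpoint u has str(u) = pre.
data EdgeAt {B : Set} : Tree B → List B → List B → Set where
  here  : ∀ {cs lab t} → (lab , t) ∈ cs → EdgeAt (node cs) [] lab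
  there : ∀ {cs lab' t pre lab} → (lab' , t) ∈ cs → EdgeAt t pre lab →
          EdgeAt (node cs) (lab' ++ pre) lab

NonEmptySuffix : {B : Set} → List B → List B → Set
NonEmptySuffix s w = (s ≢ []) × ∃ (λ u → u ++ s ≡ w)

IsSuffixTree : {A : Set} → List A → Tree (Maybe A) → Set
IsSuffixTree x T = WF true T × (∀ s → LeafStr T s ⇔ NonEmptySuffix s (x $))

Palindrome : {B : Set} → List B → Set
Palindrome w = reverse w ≡ w

-- If pre·p and pre·p·d are both palindromes then pre·p·d = reverse(d)·pre·p, so every
-- occurrence of pre·p followed by d yields another occurrence of pre·p shifted |d|
-- positions to the right.  When both are implicit nodes on the same edge, every
-- occurrence of pre·p in x$ lies on that edge and is therefore followed by d; shifting
-- forever is impossible in the finite string x$, hence d is empty.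
module Submission where

open import Defs
open import Data.Maybe using (Maybe)
open import Data.List using (List; []; _∷_; _++_; reverse; length; head)
open import Data.List.Properties
  using (++-assoc; ++-identityʳ; ++-cancelˡ; ++-conicalˡ; ++-conicalʳ; reverse-++; length-++; ∷-injective)
open import Data.List.Relation.Unary.All using () renaming (lookup to All-lookup)
open import Data.List.Relation.Unary.AllPairs using (AllPairs; _∷_)
open import Data.List.Relation.Unary.Any using (here; there)
open import Data.List.Membership.Propositional using (_∈_)
open import Data.Nat using (_≤_; _<_; s≤s)
open import Data.Nat.Properties using (m≤n+m)
open import Data.Nat.Induction using (<-wellFounded)
open import Induction.WellFounded using (Acc; acc)
open import Data.Product using (_×_; _,_; proj₁; proj₂; ∃)
open import Data.Sum using (_⊎_; inj₁; inj₂)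
open import Data.Empty using (⊥-elim)
open import Relation.Nullary using (¬_)
open import Relation.Binary.PropositionalEquality
  using (_≡_; _≢_; refl; sym; trans; cong; subst; module ≡-Reasoning)
open import Function.Bundles using (Equivalence)

module _ {B : Set} where

  head-++ : ∀ {xs : List B} ys → xs ≢ [] → head (xs ++ ys) ≡ head xs
  head-++ {[]}    _ xs≢[] = ⊥-elim (xs≢[] refl)
  head-++ {_ ∷ _} _ _     = refl

  ++-head-≡ : ∀ {xs ys : List B} us vs → xs ≢ [] → ys ≢ [] →
              xs ++ us ≡ ys ++ vs → head xs ≡ head ys
  ++-head-≡ us vs xs≢[] ys≢[] eq =
    trans (sym (head-++ us xs≢[])) (trans (cong head eq) (head-++ vs ys≢[]))

  ++-≢[]ʳ : ∀ (xs ys : List B) → ys ≢ [] → xs ++ ys ≢ []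
  ++-≢[]ʳ xs ys ys≢[] eq = ys≢[] (++-conicalʳ xs ys eq)

  ++-prefix-total : ∀ (p r p′ r′ : List B) → p ++ r ≡ p′ ++ r′ →
                    (∃ λ d → p′ ≡ p ++ d × r ≡ d ++ r′) ⊎ (∃ λ d → p ≡ p′ ++ d × r′ ≡ d ++ r)
  ++-prefix-total []      r p′       r′ eq = inj₁ (p′ , refl , eq)
  ++-prefix-total (a ∷ p) r []       r′ eq = inj₂ (a ∷ p , refl , sym eq)
  ++-prefix-total (a ∷ p) r (b ∷ p′) r′ eq with ∷-injective eq
  ... | refl , eq′ with ++-prefix-total p r p′ r′ eq′
  ...   | inj₁ (d , refl , r≡) = inj₁ (d , refl , r≡)
  ...   | inj₂ (d , refl , r′≡) = inj₂ (d , refl , r′≡)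

  length-<-++ : ∀ (d w : List B) → d ≢ [] → length w < length (d ++ w)
  length-<-++ []      w d≢[] = ⊥-elim (d≢[] refl)
  length-<-++ (_ ∷ d) w _    = s≤s (subst (length w ≤_) (sym (length-++ d)) (m≤n+m _ _))

  palindrome-extension : ∀ (P d : List B) → Palindrome P → Palindrome (P ++ d) →
                         P ++ d ≡ reverse d ++ P
  palindrome-extension P d palP palPd = begin
    P ++ d                 ≡⟨ sym palPd ⟩
    reverse (P ++ d)       ≡⟨ reverse-++ P d ⟩
    reverse d ++ reverse P ≡⟨ cong (reverse d ++_) palP ⟩
    reverse d ++ P         ∎
    where open ≡-Reasoning

  Occurrence : List B → List B → List B → Set
  Occurrence P X w = ∃ λ u → u ++ P ++ w ≡ X

  occurrence-absorbʳ : ∀ {X} P Q w → Occurrence P X (Q ++ w) → Occurrence (P ++ Q) X w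
  occurrence-absorbʳ P Q w (u , eq) = u , trans (cong (u ++_) (++-assoc P Q w)) eq

  occurrence-dropˡ : ∀ {X} P Q w → Occurrence (Q ++ P) X w → Occurrence P X w
  occurrence-dropˡ P Q w (u , eq) = u ++ Q , (begin
    (u ++ Q) ++ P ++ w ≡⟨ ++-assoc u Q (P ++ w) ⟩
    u ++ Q ++ P ++ w   ≡⟨ cong (u ++_) (sym (++-assoc Q P w)) ⟩
    u ++ (Q ++ P) ++ w ≡⟨ eq ⟩
    _                  ∎)
    where open ≡-Reasoning

  occurrence-shift : ∀ {X} P d w → P ++ d ≡ reverse d ++ P →
                     Occurrence P X (d ++ w) → Occurrence P X w
  occurrence-shift {X} P d w periodic occ =
    occurrence-dropˡ P (reverse d) w
      (subst (λ Q → Occurrence Q X w) periodic (occurrence-absorbʳ P d w occ))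

  no-occurrence-if-always-followed : ∀ {P d X} → d ≢ [] → P ++ d ≡ reverse d ++ P →
    (∀ {w} → Occurrence P X w → ∃ λ w′ → w ≡ d ++ w′) → ∀ w → ¬ Occurrence P X w
  no-occurrence-if-always-followed {P} {d} {X} d≢[] periodic followed w =
    go w (<-wellFounded (length w))
    where
    go : ∀ w → Acc _<_ (length w) → ¬ Occurrence P X w
    go w (acc rs) occ with followed occ
    ... | w′ , refl = go w′ (rs (length-<-++ d w′ d≢[])) (occurrence-shift P d w′ periodic occ)

module _ {C D : Set} (f : C → D) where

  AllPairs-≢-injective : ∀ {cs c c′} → AllPairs (λ a b → f a ≢ f b) cs →
                         c ∈ cs → c′ ∈ cs → f c ≡ f c′ → c ≡ c′
  AllPairs-≢-injective (_  ∷ _)   (here refl) (here refl) _   = refl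
  AllPairs-≢-injective (ne ∷ _)   (here refl) (there c′∈) eq  = ⊥-elim (All-lookup ne c′∈ eq)
  AllPairs-≢-injective (ne ∷ _)   (there c∈)  (here refl) eq  = ⊥-elim (All-lookup ne c∈ (sym eq))
  AllPairs-≢-injective (_  ∷ all) (there c∈)  (there c′∈) eq  = AllPairs-≢-injective all c∈ c′∈ eq

module _ {B : Set} where

  leaf-below : ∀ (t : Tree B) → ∃ (LeafStr t)
  leaf-below (node [])              = [] , leaf
  leaf-below (node ((lab , t) ∷ _)) with leaf-below t
  ... | s , ls = lab ++ s , child (here refl) ls

  EdgeAt⇒LeafStr : ∀ {T : Tree B} {pre lab} → EdgeAt T pre lab →
                   ∃ λ s → LeafStr T (pre ++ lab ++ s)
  EdgeAt⇒LeafStr (here {t = t} lab∈) with leaf-below t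
  ... | s , ls = s , child lab∈ ls
  EdgeAt⇒LeafStr (there {lab' = lab′} {pre = pre} {lab = lab} lab′∈ e) with EdgeAt⇒LeafStr e
  ... | s , ls = s , subst (LeafStr _) (sym (++-assoc lab′ pre (lab ++ s))) (child lab′∈ ls)

  -- Sibling edge labels start with distinct letters, so the path is forced onto the edge.
  leaf-continues-along-edge : ∀ {b} {T : Tree B} {pre p r s w} →
                              WF b T → EdgeAt T pre (p ++ r) → p ≢ [] →
                              LeafStr T s → s ≡ pre ++ p ++ w → ∃ λ w′ → w ≡ r ++ w′
  leaf-continues-along-edge _ (here ()) _ leaf _
  leaf-continues-along-edge _ (there () _) _ leaf _
  leaf-continues-along-edge {p = p} {r} {w = w} (wf _ children distinct) (here lab∈) p≢[]
                            (child {lab = lab₁} {s = s₁} lab₁∈ _) eq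
    with AllPairs-≢-injective (λ c → head (proj₁ c)) distinct lab₁∈ lab∈
           (trans (++-head-≡ s₁ w (proj₁ (All-lookup children lab₁∈)) p≢[] eq) (sym (head-++ r p≢[])))
  ... | refl = s₁ , sym (++-cancelˡ p (r ++ s₁) w (trans (sym (++-assoc p r s₁)) eq))
  leaf-continues-along-edge {p = p} {w = w} (wf _ children distinct)
                            (there {lab' = lab′} {pre = pre} lab′∈ e) p≢[]
                            (child {lab = lab₁} {s = s₁} lab₁∈ ls) eq
    with AllPairs-≢-injective (λ c → head (proj₁ c)) distinct lab₁∈ lab′∈
           (++-head-≡ s₁ (pre ++ p ++ w) (proj₁ (All-lookup children lab₁∈))
              (proj₁ (All-lookup children lab′∈)) (trans eq (++-assoc lab′ pre (p ++ w))))
  ... | refl = leaf-continues-along-edge (proj₂ (All-lookup children lab′∈)) e p≢[] ls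
                 (++-cancelˡ lab₁ s₁ (pre ++ p ++ w) (trans eq (++-assoc lab₁ pre (p ++ w))))

module _ {A : Set} {x : List A} {T : Tree (Maybe A)} (st : IsSuffixTree x T) where

  suffix-tree-edge-occurs : ∀ {pre lab} → EdgeAt T pre lab →
                            ∃ λ s → Occurrence pre (x $) (lab ++ s)
  suffix-tree-edge-occurs e with EdgeAt⇒LeafStr e
  ... | s , ls = s , proj₂ (Equivalence.to (proj₂ st _) ls)

  suffix-tree-occurrence-continues : ∀ {pre p r w} → EdgeAt T pre (p ++ r) → p ≢ [] →
    Occurrence (pre ++ p) (x $) w → ∃ λ w′ → w ≡ r ++ w′
  suffix-tree-occurrence-continues {pre} {p} {r} {w} e p≢[] occ =
    leaf-continues-along-edge (proj₁ st) e p≢[] (Equivalence.from (proj₂ st _) (nonempty , occ))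
      (++-assoc pre p w)
    where
    nonempty : (pre ++ p) ++ w ≢ []
    nonempty eq = ++-≢[]ʳ pre p p≢[] (++-conicalˡ (pre ++ p) w eq)

  nested-palindromes-on-edge : ∀ {pre} p d {r} → EdgeAt T pre (p ++ d ++ r) → p ≢ [] →
    Palindrome (pre ++ p) → Palindrome (pre ++ p ++ d) → d ≡ []
  nested-palindromes-on-edge p [] _ _ _ _ = refl
  nested-palindromes-on-edge {pre} p d@(_ ∷ _) {r} e p≢[] pal pal′ =
    ⊥-elim (no-occurrence-if-always-followed (λ ()) periodic followed ((d ++ r) ++ s) occurs)
    where
    periodic : (pre ++ p) ++ d ≡ reverse d ++ pre ++ p
    periodic = palindrome-extension (pre ++ p) d pal (subst Palindrome (sym (++-assoc pre p d)) pal′)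
    followed : ∀ {w} → Occurrence (pre ++ p) (x $) w → ∃ λ w′ → w ≡ d ++ w′
    followed occ with suffix-tree-occurrence-continues e p≢[] occ
    ... | w′ , refl = r ++ w′ , ++-assoc d r w′
    s = proj₁ (suffix-tree-edge-occurs e)
    occurs : Occurrence (pre ++ p) (x $) ((d ++ r) ++ s)
    occurs = occurrence-absorbʳ pre p ((d ++ r) ++ s)
      (subst (Occurrence pre (x $)) (++-assoc p (d ++ r) s) (proj₂ (suffix-tree-edge-occurs e)))

corollary2 : {A : Set} (x : List A) (T : Tree (Maybe A)) → IsSuffixTree x T →
    ∀ {pre lab : List (Maybe A)} → EdgeAt T pre lab →
    ∀ (p r p′ r′ : List (Maybe A)) →
    lab ≡ p ++ r → p ≢ [] → r ≢ [] → Palindrome (pre ++ p) →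
    lab ≡ p′ ++ r′ → p′ ≢ [] → r′ ≢ [] → Palindrome (pre ++ p′) →
    p ≡ p′
corollary2 _ T st {pre} e p r p′ r′ refl p≢[] _ pal lab≡ p′≢[] _ pal′
  with ++-prefix-total p r p′ r′ lab≡
... | inj₁ (d , refl , refl) with nested-palindromes-on-edge st p d e p≢[] pal pal′
...   | refl = sym (++-identityʳ p)
corollary2 _ T st {pre} e p r p′ r′ refl p≢[] _ pal lab≡ p′≢[] _ pal′
    | inj₂ (d , refl , refl)
    with nested-palindromes-on-edge st p′ d (subst (EdgeAt T pre) lab≡ e) p′≢[] pal′ pal
...   | refl = ++-identityʳ p′
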